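{- If an $l$-ary query $\mathcal Q$ can be maintained by a $k$-ary $\mathrm{DynQF}$ program, then $\mathcal Q$ can be maintained, on databases with at least two elements, by a $k$-ary $\mathrm{DynQF}$ program whose auxiliary schema contains, apart from function symbols, only a single relation symbol, which is $l$-ary and is the query symbol.
   Context: Dynamic setting ($\mathrm{DynQF}$): relational input schema, auxiliary schema with relation and function symbols (function symbols of arity $0$ are constants), no built-in data. Concrete modifications insert or delete a single tuple of an input relation. Update terms: variables and constants; $f(t_1,\dots,t_k)$ for function symbols $f$; $\mathrm{ite}(\phi,t_1,t_2)$ for a quantifier-free formula $\phi$ (possibly using update terms), evaluating to $t_1$ if $\phi$ holds and $t_2$ otherwise. The program has for each auxiliary relation symbol $R$ and abstract modification $\delta$ a quantifier-free formula $\varphi^R_\delta(\vec x;\vec y)$ (possibly with update terms) and for each auxiliary function symbol $f$ an update term $t^f_\delta(\vec x;\vec y)$; after $\delta(\vec a)$, $R$ becomes $\{\vec b:\text{old state}\models\varphi^R_\delta(\vec a;\vec b)\}$ and $f(\vec b)$ becomes the value of $t^f_\delta(\vec a;\vec b)$ in the old state. A dynamic program has an arbitrary initialization mapping from input databases to auxiliary structures over the same domain and an $l$-ary query symbol $Q$; it maintains an $l$-ary query if for every input database $\mathcal D$ and every finite modification sequence $\alpha$, $Q$ after applying $\alpha$ to the initial state equals $\mathcal Q(\alpha(\mathcal D))$. $k$-ary: all auxiliary relations and functions have arity at most $k$. -}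

module Defs where

open import Data.Nat using (ℕ; suc; _≤_; _+_)
open import Data.Fin using (Fin)
open import Data.Fin.Properties using () renaming (_≟_ to _≟F_)
open import Data.Vec using (Vec; []; _∷_; lookup; _++_)
open import Data.Vec.Properties using (≡-dec)
open import Data.Bool using (Bool; true; false; if_then_else_; not) renaming (_∧_ to _and_; _∨_ to _or_)
open import Data.List using (List; []; _∷_)
open import Data.Product using (_×_)
open import Relation.Nullary using (yes; no)
open import Relation.Nullary.Decidable using (⌊_⌋)
open import Relation.Binary.PropositionalEquality using (_≡_; refl; sym; subst)

-- Schemas.  Domains are Fin n (finite, no built-in data).
-- Relations are represented by their (decidable) characteristic functions.

record InSchema : Set where
  field
    nIn  : ℕ
    inAr : Fin nIn → ℕ

record AuxSchema : Set where
  field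
    nRel  : ℕ
    relAr : Fin nRel → ℕ
    nFun  : ℕ                -- number of auxiliary function symbols (arity 0 = constants)
    funAr : Fin nFun → ℕ

open InSchema
open AuxSchema

KAry : ℕ → AuxSchema → Set
KAry k τ = (∀ R → relAr τ R ≤ k) × (∀ f → funAr τ f ≤ k)

Database : InSchema → ℕ → Set
Database σ n = (S : Fin (nIn σ)) → Vec (Fin n) (inAr σ S) → Bool

record AuxStructure (τ : AuxSchema) (n : ℕ) : Set where
  field
    rel : (R : Fin (nRel τ)) → Vec (Fin n) (relAr τ R) → Bool
    fun : (f : Fin (nFun τ)) → Vec (Fin n) (funAr τ f) → Fin n

record State (σ : InSchema) (τ : AuxSchema) (n : ℕ) : Set where
  constructor ⟨_,_⟩
  field
    db  : Database σ n
    aux : AuxStructure τ n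

data Op : Set where
  ins del : Op

module Syntax (σ : InSchema) (τ : AuxSchema) where
  mutual
    data Term (m : ℕ) : Set where
      var : Fin m → Term m
      app : (f : Fin (nFun τ)) → Vec (Term m) (funAr τ f) → Term m
      ite : Formula m → Term m → Term m → Term m

    data Formula (m : ℕ) : Set where
      inAtom  : (S : Fin (nIn σ)) → Vec (Term m) (inAr σ S) → Formula m
      auxAtom : (R : Fin (nRel τ)) → Vec (Term m) (relAr τ R) → Formula m
      eqAtom  : Term m → Term m → Formula m
      true′ false′ : Formula m
      neg     : Formula m → Formula m
      conj disj : Formula m → Formula m → Formula m

  mutual
    evalT : ∀ {n m} → State σ τ n → Vec (Fin n) m → Term m → Fin n
    evalT s ρ (var i) = lookup ρ i
    evalT s ρ (app f ts) = AuxStructure.fun (State.aux s) f (evalTs s ρ ts)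
    evalT s ρ (ite φ t u) = if evalF s ρ φ then evalT s ρ t else evalT s ρ u

    evalTs : ∀ {n m k} → State σ τ n → Vec (Fin n) m → Vec (Term m) k → Vec (Fin n) k
    evalTs s ρ [] = []
    evalTs s ρ (t ∷ ts) = evalT s ρ t ∷ evalTs s ρ ts

    evalF : ∀ {n m} → State σ τ n → Vec (Fin n) m → Formula m → Bool
    evalF s ρ (inAtom S ts) = State.db s S (evalTs s ρ ts)
    evalF s ρ (auxAtom R ts) = AuxStructure.rel (State.aux s) R (evalTs s ρ ts)
    evalF s ρ (eqAtom t u) = ⌊ evalT s ρ t ≟F evalT s ρ u ⌋
    evalF s ρ true′ = true
    evalF s ρ false′ = false
    evalF s ρ (neg φ) = not (evalF s ρ φ)
    evalF s ρ (conj φ ψ) = evalF s ρ φ and evalF s ρ ψ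
    evalF s ρ (disj φ ψ) = evalF s ρ φ or evalF s ρ ψ

open Syntax public

record Mod (σ : InSchema) (n : ℕ) : Set where
  constructor mod
  field
    op   : Op
    symb : Fin (nIn σ)
    args : Vec (Fin n) (inAr σ symb)

opVal : Op → Bool
opVal ins = true
opVal del = false

applyMod : ∀ {σ n} → Mod σ n → Database σ n → Database σ n
applyMod {σ} (mod o S a) D S′ b with S′ ≟F S
... | no _ = D S′ b
... | yes refl = if ⌊ ≡-dec _≟F_ b a ⌋ then opVal o else D S′ b

applyMods : ∀ {σ n} → List (Mod σ n) → Database σ n → Database σ n
applyMods [] D = D
applyMods (δ ∷ α) D = applyMods α (applyMod δ D)

Query : InSchema → ℕ → Set
Query σ l = ∀ {n} → Database σ n → Vec (Fin n) l → Bool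

record Program (σ : InSchema) (τ : AuxSchema) (l : ℕ) : Set where
  field
    -- φ^R_δ(x;y): x = modification parameters, y = tuple of R
    updRel : (o : Op) (S : Fin (nIn σ)) (R : Fin (nRel τ)) →
             Formula σ τ (inAr σ S + relAr τ R)
    updFun : (o : Op) (S : Fin (nIn σ)) (f : Fin (nFun τ)) →
             Term σ τ (inAr σ S + funAr τ f)
    -- arbitrary initialization (domains are nonempty: Fin (suc n))
    init   : ∀ n → Database σ (suc n) → AuxStructure τ (suc n)
    qSym   : Fin (nRel τ)
    qAr    : relAr τ qSym ≡ l

module _ {σ : InSchema} {τ : AuxSchema} {l : ℕ} (P : Program σ τ l) where
  open Program P

  step : ∀ {n} → State σ τ n → Mod σ n → State σ τ n
  step s (mod o S a) = ⟨ applyMod (mod o S a) (State.db s) , newAux ⟩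
    where
    newAux : AuxStructure τ _
    AuxStructure.rel newAux R b = evalF σ τ s (a ++ b) (updRel o S R)
    AuxStructure.fun newAux f b = evalT σ τ s (a ++ b) (updFun o S f)

  run : ∀ {n} → State σ τ n → List (Mod σ n) → State σ τ n
  run s [] = s
  run s (δ ∷ α) = run (step s δ) α

  answer : ∀ {n} → State σ τ n → Vec (Fin n) l → Bool
  answer {n} s t = AuxStructure.rel (State.aux s) qSym (subst (Vec (Fin n)) (sym qAr) t)

  MaintainsFrom : ℕ → Query σ l → Set
  MaintainsFrom m Q =
    ∀ n → m ≤ suc n → (D : Database σ (suc n)) (α : List (Mod σ (suc n)))
      (t : Vec (Fin (suc n)) l) →
      answer (run ⟨ D , init n D ⟩ α) t ≡ Q (applyMods α D) t

-- The new schema τ₁ keeps the query symbol as its only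
-- relation symbol and has the function symbols
--   * every function symbol f of τ,
--   * a characteristic function χ_R of the same arity for every relation R of τ,
--   * two constants c₀, c₁ standing for "false" and "true".
-- A state s of P with two distinct elements a₀ ≠ a₁ is encoded by reading
-- χ_R(v) as a₁ if R(v) holds and a₀ otherwise, and c₀, c₁ as a₀, a₁
-- ('Encodes').  Formulas and terms over τ are translated to τ₁ by replacing
-- every atom R(t̄) with χ_R(t̄) = c₁; the translation preserves values in
-- encoded states ('translation-correct'), hence every update step of the new
-- program P₁ preserves the encoding ('step-encodes').  Initially c₀, c₁ are
-- interpreted as the first and last element, which are distinct on domains
-- of size at least two; so the query relations of P and P₁ agree forever.
module Submission where

open import Defs
open import Data.Nat using (ℕ; zero; suc; _≤_; z≤n; s≤s; _+_)
open import Data.Fin using (Fin; zero; suc; fromℕ; splitAt; _↑ˡ_; _↑ʳ_)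
open import Data.Fin.Properties using (splitAt-↑ˡ; splitAt-↑ʳ) renaming (_≟_ to _≟F_)
open import Data.Vec using (Vec; []; _∷_; _++_; lookup)
open import Data.Sum using (inj₁; inj₂)
open import Data.Bool using (Bool; true; false; if_then_else_; not; _∧_; _∨_)
open import Data.List using (List; []; _∷_)
open import Data.Product using (Σ; _×_; _,_)
open import Relation.Nullary using (¬_)
open import Relation.Nullary.Decidable using (⌊_⌋; isYes≗does; dec-true; dec-false)
open import Relation.Binary.PropositionalEquality
  using (_≡_; refl; sym; trans; cong; cong₂; subst; module ≡-Reasoning)

select : ∀ {n} (a₀ a₁ : Fin n) → Bool → Fin n
select a₀ a₁ b = if b then a₁ else a₀

select-decode : ∀ {n} {a₀ a₁ : Fin n} → ¬ a₀ ≡ a₁ → ∀ b → ⌊ select a₀ a₁ b ≟F a₁ ⌋ ≡ b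
select-decode {a₁ = a₁} _ true = trans (isYes≗does (a₁ ≟F a₁)) (dec-true (a₁ ≟F a₁) refl)
select-decode {a₀ = a₀} {a₁} a₀≢a₁ false = trans (isYes≗does (a₀ ≟F a₁)) (dec-false (a₀ ≟F a₁) a₀≢a₁)

module Construction (σ : InSchema) (τ : AuxSchema) (l : ℕ) (P : Program σ τ l) where
  open Program P
  open AuxSchema τ using (nFun; funAr; nRel; relAr)
  open AuxStructure

  data FunSym : Set where
    oldFun : Fin nFun → FunSym
    charFun : Fin nRel → FunSym
    const  : Fin 2 → FunSym

  arity : FunSym → ℕ
  arity (oldFun f) = funAr f
  arity (charFun R) = relAr R
  arity (const _) = 0

  -- FunSym is enumerated by Fin (nFun + (nRel + 2)), as schemas require.
  decode : Fin (nFun + (nRel + 2)) → FunSym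
  decode i with splitAt nFun i
  ... | inj₁ f = oldFun f
  ... | inj₂ j with splitAt nRel j
  ...   | inj₁ R = charFun R
  ...   | inj₂ c = const c

  encode : FunSym → Fin (nFun + (nRel + 2))
  encode (oldFun f) = f ↑ˡ (nRel + 2)
  encode (charFun R) = nFun ↑ʳ (R ↑ˡ 2)
  encode (const c) = nFun ↑ʳ (nRel ↑ʳ c)

  decode-encode : ∀ x → decode (encode x) ≡ x
  decode-encode (oldFun f) rewrite splitAt-↑ˡ nFun f (nRel + 2) = refl
  decode-encode (charFun R)
    rewrite splitAt-↑ʳ nFun (nRel + 2) (R ↑ˡ 2) | splitAt-↑ˡ nRel R 2 = refl
  decode-encode (const c)
    rewrite splitAt-↑ʳ nFun (nRel + 2) (nRel ↑ʳ c) | splitAt-↑ʳ nRel 2 c = refl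

  τ₁ : AuxSchema
  τ₁ = record { nRel = 1 ; relAr = λ _ → relAr qSym
              ; nFun = nFun + (nRel + 2) ; funAr = λ i → arity (decode i) }

  -- No new arities are introduced, so τ₁ is k-ary whenever τ is.
  τ₁-kary : ∀ k → KAry k τ → KAry k τ₁
  τ₁-kary k (relsₖ , funsₖ) = (λ _ → relsₖ qSym) , (λ i → arity≤k (decode i))
    where
    arity≤k : ∀ x → arity x ≤ k
    arity≤k (oldFun f) = funsₖ f
    arity≤k (charFun R) = relsₖ R
    arity≤k (const _) = z≤n

  encodeFun : ∀ {n} → AuxStructure τ n → (a₀ a₁ : Fin n) →
              (x : FunSym) → Vec (Fin n) (arity x) → Fin n
  encodeFun A a₀ a₁ (oldFun f) v = fun A f v
  encodeFun A a₀ a₁ (charFun R) v = select a₀ a₁ (rel A R v)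
  encodeFun A a₀ a₁ (const c) v = lookup (a₀ ∷ a₁ ∷ []) c

  encodeAux : ∀ {n} → AuxStructure τ n → (a₀ a₁ : Fin n) → AuxStructure τ₁ n
  rel (encodeAux A a₀ a₁) _ = rel A qSym
  fun (encodeAux A a₀ a₁) i = encodeFun A a₀ a₁ (decode i)

  appSym : ∀ {m} (x : FunSym) → Vec (Term σ τ₁ m) (arity x) → Term σ τ₁ m
  appSym {m} x ts = app (encode x) (subst (Vec (Term σ τ₁ m)) (cong arity (sym (decode-encode x))) ts)

  c₀ c₁ : ∀ {m} → Term σ τ₁ m
  c₀ = appSym (const zero) []
  c₁ = appSym (const (suc zero)) []

  mutual
    translateT : ∀ {m} → Term σ τ m → Term σ τ₁ m
    translateT (var i) = var i
    translateT (app f ts) = appSym (oldFun f) (translateTs ts)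
    translateT (ite φ t u) = ite (translateF φ) (translateT t) (translateT u)

    translateTs : ∀ {m k} → Vec (Term σ τ m) k → Vec (Term σ τ₁ m) k
    translateTs [] = []
    translateTs (t ∷ ts) = translateT t ∷ translateTs ts

    translateF : ∀ {m} → Formula σ τ m → Formula σ τ₁ m
    translateF (inAtom S ts) = inAtom S (translateTs ts)
    translateF (auxAtom R ts) = eqAtom (appSym (charFun R) (translateTs ts)) c₁
    translateF (eqAtom t u) = eqAtom (translateT t) (translateT u)
    translateF true′ = true′
    translateF false′ = false′
    translateF (neg φ) = neg (translateF φ)
    translateF (conj φ ψ) = conj (translateF φ) (translateF ψ)
    translateF (disj φ ψ) = disj (translateF φ) (translateF ψ)

  updateSym : ∀ o S (x : FunSym) → Term σ τ₁ (InSchema.inAr σ S + arity x)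
  updateSym o S (oldFun f) = translateT (updFun o S f)
  updateSym o S (charFun R) = ite (translateF (updRel o S R)) c₁ c₀
  updateSym o S (const c) = appSym (const c) []

  P₁ : Program σ τ₁ l
  P₁ = record
    { updRel = λ o S _ → translateF (updRel o S qSym)
    ; updFun = λ o S i → updateSym o S (decode i)
    ; init   = λ n D → encodeAux (init n D) zero (fromℕ n)
    ; qSym   = zero
    ; qAr    = qAr
    }

  record Encodes {n} (a₀ a₁ : Fin n) (s : State σ τ n) (s₁ : State σ τ₁ n) : Set where
    field
      same-db  : State.db s₁ ≡ State.db s
      fun-enc  : ∀ i v → fun (State.aux s₁) i v ≡ encodeFun (State.aux s) a₀ a₁ (decode i) v
      query-enc : ∀ j v → rel (State.aux s₁) j v ≡ rel (State.aux s) qSym v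
      distinct : ¬ a₀ ≡ a₁

  transport-app : ∀ {n m} (A : AuxStructure τ n) a₀ a₁ (s₁ : State σ τ₁ n) (ρ : Vec (Fin n) m)
    (y x : FunSym) (y≡x : y ≡ x) (ts : Vec (Term σ τ₁ m) (arity x)) →
    encodeFun A a₀ a₁ y (evalTs σ τ₁ s₁ ρ (subst (Vec (Term σ τ₁ m)) (cong arity (sym y≡x)) ts))
      ≡ encodeFun A a₀ a₁ x (evalTs σ τ₁ s₁ ρ ts)
  transport-app A a₀ a₁ s₁ ρ x .x refl ts = refl

  module _ {n} {a₀ a₁ : Fin n} {s : State σ τ n} {s₁ : State σ τ₁ n}
           (enc : Encodes a₀ a₁ s s₁) where
    open Encodes enc

    appSym-correct : ∀ {m} (ρ : Vec (Fin n) m) x ts →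
      evalT σ τ₁ s₁ ρ (appSym x ts) ≡ encodeFun (State.aux s) a₀ a₁ x (evalTs σ τ₁ s₁ ρ ts)
    appSym-correct ρ x ts =
      trans (fun-enc (encode x) _)
            (transport-app (State.aux s) a₀ a₁ s₁ ρ (decode (encode x)) x (decode-encode x) ts)

    mutual
      translateT-correct : ∀ {m} (ρ : Vec (Fin n) m) t →
        evalT σ τ₁ s₁ ρ (translateT t) ≡ evalT σ τ s ρ t
      translateT-correct ρ (var i) = refl
      translateT-correct ρ (app f ts) =
        trans (appSym-correct ρ (oldFun f) (translateTs ts))
              (cong (fun (State.aux s) f) (translateTs-correct ρ ts))
      translateT-correct ρ (ite φ t u)
        rewrite translateF-correct ρ φ | translateT-correct ρ t | translateT-correct ρ u = refl

      translateTs-correct : ∀ {m k} (ρ : Vec (Fin n) m) (ts : Vec (Term σ τ m) k) →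
        evalTs σ τ₁ s₁ ρ (translateTs ts) ≡ evalTs σ τ s ρ ts
      translateTs-correct ρ [] = refl
      translateTs-correct ρ (t ∷ ts) = cong₂ _∷_ (translateT-correct ρ t) (translateTs-correct ρ ts)

      translateF-correct : ∀ {m} (ρ : Vec (Fin n) m) φ →
        evalF σ τ₁ s₁ ρ (translateF φ) ≡ evalF σ τ s ρ φ
      translateF-correct ρ (inAtom S ts) = cong₂ (λ D v → D S v) same-db (translateTs-correct ρ ts)
      translateF-correct ρ (auxAtom R ts) = begin
        ⌊ evalT σ τ₁ s₁ ρ (appSym (charFun R) (translateTs ts)) ≟F evalT σ τ₁ s₁ ρ c₁ ⌋
          ≡⟨ cong₂ (λ x y → ⌊ x ≟F y ⌋) (appSym-correct ρ (charFun R) (translateTs ts))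
                                        (appSym-correct ρ (const (suc zero)) []) ⟩
        ⌊ select a₀ a₁ (rel (State.aux s) R (evalTs σ τ₁ s₁ ρ (translateTs ts))) ≟F a₁ ⌋
          ≡⟨ cong (λ v → ⌊ select a₀ a₁ (rel (State.aux s) R v) ≟F a₁ ⌋) (translateTs-correct ρ ts) ⟩
        ⌊ select a₀ a₁ (rel (State.aux s) R (evalTs σ τ s ρ ts)) ≟F a₁ ⌋
          ≡⟨ select-decode distinct _ ⟩
        rel (State.aux s) R (evalTs σ τ s ρ ts) ∎
        where open ≡-Reasoning
      translateF-correct ρ (eqAtom t u) =
        cong₂ (λ x y → ⌊ x ≟F y ⌋) (translateT-correct ρ t) (translateT-correct ρ u)
      translateF-correct ρ true′ = refl
      translateF-correct ρ false′ = refl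
      translateF-correct ρ (neg φ) = cong not (translateF-correct ρ φ)
      translateF-correct ρ (conj φ ψ) = cong₂ _∧_ (translateF-correct ρ φ) (translateF-correct ρ ψ)
      translateF-correct ρ (disj φ ψ) = cong₂ _∨_ (translateF-correct ρ φ) (translateF-correct ρ ψ)

    step-encodes : ∀ δ → Encodes a₀ a₁ (step P s δ) (step P₁ s₁ δ)
    step-encodes (mod o S a) = record
      { same-db   = cong (applyMod (mod o S a)) same-db
      ; fun-enc   = λ i → update-correct (decode i)
      ; query-enc = λ _ v → translateF-correct (a ++ v) (updRel o S qSym)
      ; distinct  = distinct
      }
      where
      update-correct : ∀ x v → evalT σ τ₁ s₁ (a ++ v) (updateSym o S x)
                             ≡ encodeFun (State.aux (step P s (mod o S a))) a₀ a₁ x v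
      update-correct (oldFun f) v = translateT-correct (a ++ v) (updFun o S f)
      update-correct (charFun R) v
        rewrite translateF-correct (a ++ v) (updRel o S R)
              | appSym-correct (a ++ v) (const (suc zero)) []
              | appSym-correct (a ++ v) (const zero) [] = refl
      update-correct (const c) [] = appSym-correct (a ++ []) (const c) []

  run-encodes : ∀ {n} {a₀ a₁ : Fin n} {s s₁} (α : List (Mod σ n)) →
    Encodes a₀ a₁ s s₁ → Encodes a₀ a₁ (run P s α) (run P₁ s₁ α)
  run-encodes [] enc = enc
  run-encodes (δ ∷ α) enc = run-encodes α (step-encodes enc δ)

  init-encodes : ∀ n (D : Database σ (suc (suc n))) →
    Encodes zero (fromℕ (suc n)) ⟨ D , init (suc n) D ⟩ ⟨ D , Program.init P₁ (suc n) D ⟩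
  init-encodes n D = record
    { same-db = refl ; fun-enc = λ _ _ → refl ; query-enc = λ _ _ → refl ; distinct = λ () }

  P₁-maintains : (Q : Query σ l) → MaintainsFrom P 1 Q → MaintainsFrom P₁ 2 Q
  P₁-maintains Q P-maintains zero (s≤s ())
  P₁-maintains Q P-maintains (suc n) _ D α t =
    trans (Encodes.query-enc (run-encodes α (init-encodes n D)) zero _)
          (P-maintains (suc n) (s≤s z≤n) D α t)

lemma5p6 : (σ : InSchema) (l k : ℕ) (Q : Query σ l) →
    (Σ AuxSchema λ τ → KAry k τ × Σ (Program σ τ l) λ P → MaintainsFrom P 1 Q) →
    Σ AuxSchema λ τ′ → KAry k τ′ × (AuxSchema.nRel τ′ ≡ 1) ×
    Σ (Program σ τ′ l) λ P′ → MaintainsFrom P′ 2 Q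
lemma5p6 σ l k Q (τ , τ-kary , P , P-maintains) =
  τ₁ , τ₁-kary k τ-kary , refl , P₁ , P₁-maintains Q P-maintains
  where open Construction σ τ l P
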